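{- Let $n\ge 1$ and $m\ge 2$ be integers, let $G$ be a finite region-connected $n$-simplex graph with chromatic number $\chi(G)=n+1$, and let $c:V(G)\to\{0,1,\dots,n\}$ be a proper vertex coloring of $G$. On the set of all labelings $V(G)\to\mathbb{Z}_m$, define $L_1\sim L_2$ if $P_c[L_1]=P_c[L_2]$. Then $\sim$ has exactly $m^n$ distinct equivalence classes.
   Context: All graphs are finite simple graphs. An $n$-simplex of a graph $G$ is a set of $n+1$ vertices of $G$ that are pairwise adjacent. $G$ is an $n$-simplex graph if $G$ is a union of complete subgraphs on $n+1$ vertices (every vertex and every edge of $G$ lies in some $n$-simplex of $G$). Two $n$-simplexes $S,S'$ are adjacent if $|S\cap S'|=n$; $G$ is region-connected if for any two $n$-simplexes $S,S'$ there is a sequence $S=S_1,S_2,\dots,S_t=S'$ of $n$-simplexes with $S_j$ adjacent to $S_{j+1}$ for all $j$. A labeling is a map $L:V(G)\to\mathbb{Z}_m$. Let $\zeta=e^{2\pi i/m}$. For $0\le k<n$ let $i_k$ be the $n\times n$ complex diagonal matrix with $\zeta$ in diagonal position $k+1$ and $1$ in all other diagonal positions, and let $i_n=\zeta^{m-1}I_n$. For a proper coloring $c:V(G)\to\{0,\dots,n\}$ and a labeling $L$, define $P_c[L]=\prod_{v\in V(G)} i_{c(v)}^{\,L(v)}$ (well defined since these matrices commute and satisfy $i_k^m=I_n$). -}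

module Defs where

open import Data.Nat using (ℕ; zero; suc; _+_; _∸_; _≡ᵇ_; NonZero)
open import Data.Nat.DivMod using (_mod_)
open import Data.Fin using (Fin; toℕ) renaming (zero to fz; suc to fs)
open import Data.Fin.Subset using (Subset; _∈_; _∩_; ∣_∣)
open import Data.Vec using (Vec; zipWith; replicate; tabulate)
open import Data.Bool using (if_then_else_)
open import Data.Product using (Σ; _×_; ∃)
open import Relation.Binary.PropositionalEquality using (_≡_; _≢_)
open import Relation.Binary.Construct.Closure.ReflexiveTransitive using (Star)
open import Relation.Nullary using (¬_)

record Graph (V : ℕ) : Set₁ where
  field
    Adj    : Fin V → Fin V → Set
    sym    : ∀ {u v} → Adj u v → Adj v u
    irrefl : ∀ {v} → ¬ Adj v v
open Graph public

Proper : ∀ {V} → Graph V → (k : ℕ) → (Fin V → Fin k) → Set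
Proper G k c = ∀ u v → Adj G u v → c u ≢ c v

Colorable : ∀ {V} → Graph V → ℕ → Set
Colorable G k = Σ (Fin _ → Fin k) (Proper G k)

ChromaticNumberSuc : ∀ {V} → Graph V → ℕ → Set
ChromaticNumberSuc G k = Colorable G (suc k) × ¬ Colorable G k

IsSimplex : ∀ {V} → Graph V → ℕ → Subset V → Set
IsSimplex G n S =
  (∣ S ∣ ≡ suc n) × (∀ u v → u ∈ S → v ∈ S → u ≢ v → Adj G u v)

IsSimplexGraph : ∀ {V} → Graph V → ℕ → Set
IsSimplexGraph G n =
  (∀ v → ∃ λ S → IsSimplex G n S × v ∈ S) ×
  (∀ u v → Adj G u v → ∃ λ S → IsSimplex G n S × u ∈ S × v ∈ S)

AdjSimplex : ∀ {V} → Graph V → ℕ → Subset V → Subset V → Set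
AdjSimplex G n S T = IsSimplex G n S × IsSimplex G n T × (∣ S ∩ T ∣ ≡ n)

RegionConnected : ∀ {V} → Graph V → ℕ → Set
RegionConnected G n =
  ∀ S T → IsSimplex G n S → IsSimplex G n T → Star (AdjSimplex G n) S T

-- Z_m and the diagonal matrices diag(ζ^{e_1},…,ζ^{e_n}), ζ = e^{2πi/m}.
-- Such a matrix is encoded by its exponent vector (e_1,…,e_n) ∈ (Z_m)^n;
-- matrix product = pointwise addition of exponents mod m.

ZMod : ℕ → Set
ZMod m = Fin m

addZ : ∀ {m} .{{_ : NonZero m}} → ZMod m → ZMod m → ZMod m
addZ {m} a b = (toℕ a + toℕ b) mod m

Diag : ℕ → ℕ → Set
Diag n m = Vec (ZMod m) n

_⊙_ : ∀ {n m} .{{_ : NonZero m}} → Diag n m → Diag n m → Diag n m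
_⊙_ = zipWith addZ

Id : ∀ {n} m .{{_ : NonZero m}} → Diag n m
Id m = replicate _ (0 mod m)

-- the generators i_0,…,i_n : i_k = diag with ζ in position k+1 (k < n),
-- i_n = ζ^{m-1} I_n
gen : ∀ n m .{{_ : NonZero m}} → Fin (suc n) → Diag n m
gen n m k = tabulate λ p →
  if toℕ k ≡ᵇ n then (m ∸ 1) mod m
  else (if toℕ p ≡ᵇ toℕ k then 1 mod m else 0 mod m)

pow : ∀ {n} m .{{_ : NonZero m}} → Diag n m → ℕ → Diag n m
pow m D zero    = Id m
pow m D (suc e) = D ⊙ pow m D e

prodV : ∀ {n} m .{{_ : NonZero m}} {V} → (Fin V → Diag n m) → Diag n m
prodV m {zero}  f = Id m
prodV m {suc V} f = f fz ⊙ prodV m (λ v → f (fs v))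

P : ∀ {V} n m .{{_ : NonZero m}} → (Fin V → Fin (suc n)) → (Fin V → ZMod m) → Diag n m
P n m c L = prodV m (λ v → pow m (gen n m (c v)) (toℕ (L v)))

{-# OPTIONS --safe #-}
module Submission where

-- In exponent coordinates P_c is a map from labellings to (Z_m)^n, and P_c[L₁] = P_c[L₂] says
-- that L₁ and L₂ lie in the same fibre; so it suffices to show that P_c is onto and to number
-- (Z_m)^n by Fin (m ^ n). For q < n the generator i_q is the q-th unit vector. Since χ(G) = n+1,
-- every colour occurs in c, so labelling one vertex of each colour q < n by the q-th coordinate
-- of a target d, and every other vertex by 0, gives P_c[L] = d.

open import Defs hiding (sym)
open import Data.Nat using (ℕ; suc; _≤_; _^_; NonZero)
open import Data.Fin using (Fin)
open import Data.Product using (Σ; _×_; ∃)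
open import Relation.Binary.PropositionalEquality using (_≡_)
open import Function.Bundles using (_⇔_)

open import Algebra.Bundles using (CommutativeMonoid)
open import Data.Bool using (if_then_else_)
open import Data.Fin using (toℕ; fromℕ; inject₁; punchIn; punchOut; finToFun; funToFin; combine)
  renaming (zero to fzero; suc to fsuc)
open import Data.Fin.Properties
  using (_≟_; any?; toℕ-fromℕ<; toℕ<n; toℕ-injective; toℕ-inject₁; toℕ-inject₁-≢;
         punchInᵢ≢i; punchOut-injective; finToFun-funToFin; funToFin-finToFin)
open import Data.Fin.Relation.Unary.Top using (view; ‵fromℕ; ‵inject₁)
open import Data.Nat using (zero; _+_; _*_; _∸_; _%_; _≡ᵇ_)
open import Data.Nat.DivMod using (_mod_; %-distribˡ-+; %-distribˡ-*; m%n%n≡m%n; m<n⇒m%n≡m)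
import Data.Nat.Properties as ℕ
open import Data.Product using (_,_; proj₁; proj₂)
open import Data.Vec using (Vec; []; _∷_; _∷ʳ_; lookup; tabulate)
open import Data.Vec.Functional using (Vector; replicate)
open import Data.Vec.Properties using (lookup-zipWith; lookup-replicate; lookup∘tabulate)
open import Data.Vec.Relation.Binary.Pointwise.Extensional using (ext; Pointwise-≡⇒≡)
open import Function using (_∘_)
open import Function.Bundles using (mk⇔)
open import Relation.Binary.PropositionalEquality
  using (_≢_; _≗_; refl; sym; trans; cong; cong₂; module ≡-Reasoning)
open import Relation.Nullary using (¬_; Dec; does; yes; no; contradiction)
open import Relation.Nullary.Decidable using (dec-true; dec-false)

0%n≡0 : ∀ n .{{_ : NonZero n}} → 0 % n ≡ 0
0%n≡0 (suc n) = refl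

[m+[n%d]]%d≡[m+n]%d : ∀ m n d .{{_ : NonZero d}} → (m + n % d) % d ≡ (m + n) % d
[m+[n%d]]%d≡[m+n]%d m n d = begin
  (m + n % d) % d           ≡⟨ %-distribˡ-+ m (n % d) d ⟩
  (m % d + n % d % d) % d   ≡⟨ cong (λ k → (m % d + k) % d) (m%n%n≡m%n n d) ⟩
  (m % d + n % d) % d       ≡⟨ %-distribˡ-+ m n d ⟨
  (m + n) % d               ∎
  where open ≡-Reasoning

[m*[n%d]]%d≡[m*n]%d : ∀ m n d .{{_ : NonZero d}} → (m * (n % d)) % d ≡ (m * n) % d
[m*[n%d]]%d≡[m*n]%d m n d = begin
  (m * (n % d)) % d         ≡⟨ %-distribˡ-* m (n % d) d ⟩
  (m % d * (n % d % d)) % d ≡⟨ cong (λ k → (m % d * k) % d) (m%n%n≡m%n n d) ⟩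
  (m % d * (n % d)) % d     ≡⟨ %-distribˡ-* m n d ⟨
  (m * n) % d               ∎
  where open ≡-Reasoning

module _ {a ℓ} (M : CommutativeMonoid a ℓ) where
  open CommutativeMonoid M
  open import Algebra.Properties.CommutativeMonoid.Sum M
    using (sum; sum-remove; sum-cong-≋; sum-replicate-zero)
  open import Relation.Binary.Reasoning.Setoid setoid

  sum-δ : ∀ {n} (t : Vector Carrier n) i → (∀ j → j ≢ i → t j ≈ ε) → sum t ≈ t i
  sum-δ {suc n} t i t≈ε = begin
    sum t                     ≈⟨ sum-remove t ⟩
    t i ∙ sum (t ∘ punchIn i) ≈⟨ ∙-congˡ (sum-cong-≋ (λ j → t≈ε (punchIn i j) (punchInᵢ≢i i j))) ⟩
    t i ∙ sum (replicate n ε) ≈⟨ ∙-congˡ (sum-replicate-zero n) ⟩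
    t i ∙ ε                   ≈⟨ identityʳ (t i) ⟩
    t i                       ∎

open import Algebra.Properties.CommutativeMonoid.Sum ℕ.+-0-commutativeMonoid using (sum)

funToFin-cong : ∀ {m n} {f g : Fin n → Fin m} → f ≗ g → funToFin f ≡ funToFin g
funToFin-cong {n = zero}  f≗g = refl
funToFin-cong {n = suc n} f≗g = cong₂ combine (f≗g fzero) (funToFin-cong (f≗g ∘ fsuc))

vecToFin : ∀ {m n} → Vec (Fin m) n → Fin (m ^ n)
vecToFin = funToFin ∘ lookup

vecToFin-injective : ∀ {m n} {xs ys : Vec (Fin m) n} → vecToFin xs ≡ vecToFin ys → xs ≡ ys
vecToFin-injective {xs = xs} {ys} eq = Pointwise-≡⇒≡ (ext λ i → begin
  lookup xs i                ≡⟨ finToFun-funToFin (lookup xs) i ⟨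
  finToFun (vecToFin xs) i   ≡⟨ cong (λ k → finToFun k i) eq ⟩
  finToFun (vecToFin ys) i   ≡⟨ finToFun-funToFin (lookup ys) i ⟩
  lookup ys i                ∎)
  where open ≡-Reasoning

vecToFin-surjective : ∀ {m n} (k : Fin (m ^ n)) → ∃ λ xs → vecToFin {m} {n} xs ≡ k
vecToFin-surjective {m} {n} k = xs , (begin
  vecToFin xs                   ≡⟨ funToFin-cong (lookup∘tabulate (finToFun {m} {n} k)) ⟩
  funToFin (finToFun {m} {n} k) ≡⟨ funToFin-finToFin {n} k ⟩
  k                             ∎)
  where
  open ≡-Reasoning
  xs : Vec (Fin m) n
  xs = tabulate (finToFun k)

lookup-∷ʳ-inject₁ : ∀ {a} {A : Set a} {n} (xs : Vec A n) x i →
                    lookup (xs ∷ʳ x) (inject₁ i) ≡ lookup xs i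
lookup-∷ʳ-inject₁ (y ∷ xs) x fzero    = refl
lookup-∷ʳ-inject₁ (y ∷ xs) x (fsuc i) = lookup-∷ʳ-inject₁ xs x i

lookup-∷ʳ-fromℕ : ∀ {a} {A : Set a} {n} (xs : Vec A n) x → lookup (xs ∷ʳ x) (fromℕ n) ≡ x
lookup-∷ʳ-fromℕ []       x = refl
lookup-∷ʳ-fromℕ (y ∷ xs) x = lookup-∷ʳ-fromℕ xs x

every-colour-used : ∀ {V k} (G : Graph V) (c : Fin V → Fin (suc k)) →
                    ¬ Colorable G k → Proper G (suc k) c → ∀ j → ∃ λ v → c v ≡ j
every-colour-used {V} {k} G c ¬colourable proper j with any? (λ v → c v ≟ j)
... | yes used  = used
... | no unused = contradiction (c′ , proper′) ¬colourable
  where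
  c′ : Fin V → Fin k
  c′ v = punchOut {i = j} {j = c v} (λ j≡cv → unused (v , sym j≡cv))
  proper′ : Proper G k c′
  proper′ u v adj c′u≡c′v = proper u v adj (punchOut-injective {i = j} _ _ c′u≡c′v)

module _ {n m : ℕ} .{{_ : NonZero m}} where

  toℕ-mod : ∀ a → toℕ (a mod m) ≡ a % m
  toℕ-mod a = toℕ-fromℕ< _

  toℕ-0mod : toℕ (0 mod m) ≡ 0
  toℕ-0mod = trans (toℕ-mod 0) (0%n≡0 m)

  toℕ-lookup-⊙ : ∀ (A B : Diag n m) p →
                 toℕ (lookup (A ⊙ B) p) ≡ (toℕ (lookup A p) + toℕ (lookup B p)) % m
  toℕ-lookup-⊙ A B p = trans (cong toℕ (lookup-zipWith addZ p A B)) (toℕ-mod _)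

  toℕ-lookup-Id : ∀ p → toℕ (lookup (Id {n} m) p) ≡ 0
  toℕ-lookup-Id p = trans (cong toℕ (lookup-replicate p _)) toℕ-0mod

  toℕ-lookup-pow : ∀ (A : Diag n m) e p → toℕ (lookup (pow m A e) p) ≡ (e * toℕ (lookup A p)) % m
  toℕ-lookup-pow A zero    p = trans (toℕ-lookup-Id p) (sym (0%n≡0 m))
  toℕ-lookup-pow A (suc e) p = begin
    toℕ (lookup (A ⊙ pow m A e) p)      ≡⟨ toℕ-lookup-⊙ A (pow m A e) p ⟩
    (a + toℕ (lookup (pow m A e) p)) % m ≡⟨ cong (λ k → (a + k) % m) (toℕ-lookup-pow A e p) ⟩
    (a + (e * a) % m) % m               ≡⟨ [m+[n%d]]%d≡[m+n]%d a (e * a) m ⟩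
    (a + e * a) % m                     ∎
    where
    open ≡-Reasoning
    a = toℕ (lookup A p)

  toℕ-lookup-prodV : ∀ {W} (f : Fin W → Diag n m) (x : Fin W → ℕ) p →
                     (∀ w → toℕ (lookup (f w) p) ≡ x w % m) →
                     toℕ (lookup (prodV m f) p) ≡ sum x % m
  toℕ-lookup-prodV {zero}  f x p fx = trans (toℕ-lookup-Id p) (sym (0%n≡0 m))
  toℕ-lookup-prodV {suc W} f x p fx = begin
    toℕ (lookup (f fzero ⊙ prodV m (f ∘ fsuc)) p)
      ≡⟨ toℕ-lookup-⊙ (f fzero) _ p ⟩
    (toℕ (lookup (f fzero) p) + toℕ (lookup (prodV m (f ∘ fsuc)) p)) % m
      ≡⟨ cong₂ (λ a b → (a + b) % m) (fx fzero)
               (toℕ-lookup-prodV (f ∘ fsuc) (x ∘ fsuc) p (fx ∘ fsuc)) ⟩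
    (x fzero % m + sum (x ∘ fsuc) % m) % m
      ≡⟨ %-distribˡ-+ (x fzero) (sum (x ∘ fsuc)) m ⟨
    sum x % m
      ∎
    where open ≡-Reasoning

  toℕ-lookup-P : ∀ {V} (c : Fin V → Fin (suc n)) (L : Fin V → ZMod m) p →
                 toℕ (lookup (P n m c L) p) ≡ sum (λ v → toℕ (L v) * toℕ (lookup (gen n m (c v)) p)) % m
  toℕ-lookup-P c L p = toℕ-lookup-prodV _ _ p (λ v → toℕ-lookup-pow (gen n m (c v)) (toℕ (L v)) p)

  lookup-gen-inject₁ : ∀ q p →
                       lookup (gen n m (inject₁ q)) p ≡ (if toℕ p ≡ᵇ toℕ q then 1 mod m else 0 mod m)
  lookup-gen-inject₁ q p = begin
    lookup (gen n m (inject₁ q)) p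
      ≡⟨ lookup∘tabulate _ p ⟩
    (if toℕ (inject₁ q) ≡ᵇ n then (m ∸ 1) mod m else diagonal (toℕ (inject₁ q)))
      ≡⟨ cong (λ b → if b then (m ∸ 1) mod m else diagonal (toℕ (inject₁ q)))
              (dec-false (toℕ (inject₁ q) ℕ.≟ n) (toℕ-inject₁-≢ q ∘ sym)) ⟩
    diagonal (toℕ (inject₁ q))
      ≡⟨ cong diagonal (toℕ-inject₁ q) ⟩
    diagonal (toℕ q)
      ∎
    where
    open ≡-Reasoning
    diagonal : ℕ → ZMod m
    diagonal k = if toℕ p ≡ᵇ k then 1 mod m else 0 mod m

  lookup-gen-inject₁-diagonal : ∀ p → lookup (gen n m (inject₁ p)) p ≡ 1 mod m
  lookup-gen-inject₁-diagonal p =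
    trans (lookup-gen-inject₁ p p)
          (cong (λ b → if b then 1 mod m else 0 mod m) (dec-true (toℕ p ℕ.≟ toℕ p) refl))

  lookup-gen-inject₁-offDiagonal : ∀ {q p} → q ≢ p → lookup (gen n m (inject₁ q)) p ≡ 0 mod m
  lookup-gen-inject₁-offDiagonal {q} {p} q≢p =
    trans (lookup-gen-inject₁ q p)
          (cong (λ b → if b then 1 mod m else 0 mod m)
                (dec-false (toℕ p ℕ.≟ toℕ q) (q≢p ∘ sym ∘ toℕ-injective)))

  module Preimage {V} (c : Fin V → Fin (suc n))
                  (rep : Fin (suc n) → Fin V) (c∘rep : ∀ k → c (rep k) ≡ k)
                  (d : Diag n m) where

    -- Colour n gets label 0: its generator i_n = ζ^{m-1} I is the only one that is not a unit vector.

    colourLabel : Fin (suc n) → ZMod m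
    colourLabel = lookup (d ∷ʳ 0 mod m)

    label : Fin V → ZMod m
    label v = if does (v ≟ rep (c v)) then colourLabel (c v) else 0 mod m

    label-representative : ∀ {v} → v ≡ rep (c v) → label v ≡ colourLabel (c v)
    label-representative {v} v≡rep =
      cong (λ b → if b then colourLabel (c v) else 0 mod m) (dec-true (v ≟ rep (c v)) v≡rep)

    label-other : ∀ {v} → v ≢ rep (c v) → label v ≡ 0 mod m
    label-other {v} v≢rep =
      cong (λ b → if b then colourLabel (c v) else 0 mod m) (dec-false (v ≟ rep (c v)) v≢rep)

    colourSummand : Fin n → Fin (suc n) → ℕ
    colourSummand p k = toℕ (colourLabel k) * toℕ (lookup (gen n m k) p)

    summand : Fin n → Fin V → ℕ
    summand p v = toℕ (label v) * toℕ (lookup (gen n m (c v)) p)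

    colourSummand-diagonal : ∀ p → colourSummand p (inject₁ p) ≡ toℕ (lookup d p) * (1 % m)
    colourSummand-diagonal p = cong₂ (λ a b → toℕ a * b)
      (lookup-∷ʳ-inject₁ d _ p)
      (trans (cong toℕ (lookup-gen-inject₁-diagonal p)) (toℕ-mod 1))

    colourSummand-other : ∀ p k → k ≢ inject₁ p → colourSummand p k ≡ 0
    colourSummand-other p k k≢p with view k
    ... | ‵fromℕ     = cong (_* toℕ (lookup (gen n m (fromℕ n)) p))
                            (trans (cong toℕ (lookup-∷ʳ-fromℕ d _)) toℕ-0mod)
    ... | ‵inject₁ q = begin
      a * toℕ (lookup (gen n m (inject₁ q)) p)
        ≡⟨ cong (λ b → a * toℕ b) (lookup-gen-inject₁-offDiagonal (k≢p ∘ cong inject₁)) ⟩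
      a * toℕ (0 mod m)
        ≡⟨ cong (a *_) toℕ-0mod ⟩
      a * 0
        ≡⟨ ℕ.*-zeroʳ a ⟩
      0
        ∎
      where
      open ≡-Reasoning
      a = toℕ (colourLabel (inject₁ q))

    summand-representative : ∀ p {v} → v ≡ rep (c v) → summand p v ≡ colourSummand p (c v)
    summand-representative p v≡rep = cong (λ a → toℕ a * _) (label-representative v≡rep)

    summand-other : ∀ p v → v ≢ rep (inject₁ p) → summand p v ≡ 0
    summand-other p v v≢w = byRepresentative (v ≟ rep (c v))
      where
      byRepresentative : Dec (v ≡ rep (c v)) → summand p v ≡ 0
      byRepresentative (yes v≡rep) =
        trans (summand-representative p v≡rep)
              (colourSummand-other p (c v) (v≢w ∘ trans v≡rep ∘ cong rep))
      byRepresentative (no v≢rep) =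
        cong (_* toℕ (lookup (gen n m (c v)) p)) (trans (cong toℕ (label-other v≢rep)) toℕ-0mod)

    P-label : P n m c label ≡ d
    P-label = Pointwise-≡⇒≡ (ext coordinate)
      where
      coordinate : ∀ p → lookup (P n m c label) p ≡ lookup d p
      coordinate p = toℕ-injective (begin
        toℕ (lookup (P n m c label) p)
          ≡⟨ toℕ-lookup-P c label p ⟩
        sum (summand p) % m
          ≡⟨ cong (_% m) (sum-δ ℕ.+-0-commutativeMonoid (summand p) w (summand-other p)) ⟩
        summand p w % m
          ≡⟨ cong (_% m) (trans (summand-representative p w≡rep) (cong (colourSummand p) (c∘rep _))) ⟩
        colourSummand p (inject₁ p) % m
          ≡⟨ cong (_% m) (colourSummand-diagonal p) ⟩
        (dₚ * (1 % m)) % m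
          ≡⟨ [m*[n%d]]%d≡[m*n]%d dₚ 1 m ⟩
        (dₚ * 1) % m
          ≡⟨ cong (_% m) (ℕ.*-identityʳ dₚ) ⟩
        dₚ % m
          ≡⟨ m<n⇒m%n≡m (toℕ<n (lookup d p)) ⟩
        dₚ
          ∎)
        where
        open ≡-Reasoning
        dₚ = toℕ (lookup d p)
        w = rep (inject₁ p)
        w≡rep : w ≡ rep (c w)
        w≡rep = cong rep (sym (c∘rep _))

  P-surjective : ∀ {V} (c : Fin V → Fin (suc n)) → (∀ k → ∃ λ v → c v ≡ k) →
                 ∀ d → ∃ λ L → P n m c L ≡ d
  P-surjective c c-surjective d = label , P-label
    where open Preimage c (proj₁ ∘ c-surjective) (proj₂ ∘ c-surjective) d

corollary4p6p4 : (n m : ℕ) .{{_ : NonZero m}} → 1 ≤ n → 2 ≤ m →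
    {V : ℕ} (G : Graph V) → RegionConnected G n → IsSimplexGraph G n →
    ChromaticNumberSuc G n →
    (c : Fin V → Fin (suc n)) → Proper G (suc n) c →
    Σ ((Fin V → ZMod m) → Fin (m ^ n)) λ f →
      (∀ L₁ L₂ → (P n m c L₁ ≡ P n m c L₂) ⇔ (f L₁ ≡ f L₂)) ×
      (∀ k → ∃ λ L → f L ≡ k)
corollary4p6p4 n m _ _ G _ _ (_ , ¬colourable) c proper =
  vecToFin ∘ P n m c ,
  (λ _ _ → mk⇔ (cong vecToFin) vecToFin-injective) ,
  λ k → let d , d↦k = vecToFin-surjective k
            L , L↦d = P-surjective c (every-colour-used G c ¬colourable proper) d
        in L , trans (cong vecToFin L↦d) d↦k
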